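{- Let $(b_n)_{n\in\mathbb Z}$ be an integer lens sequence. If $\gcd(b_k,b_{k+1},b_{k+2})=m$ holds for some $k\in\mathbb Z$, then $\gcd(b_k,b_{k+1},b_{k+2})=m$ holds for all $k\in\mathbb Z$.
   Context: A lens sequence is a bilateral real sequence $(b_n)_{n\in\mathbb Z}$ obtained from a seed $(a,b,c)$ with $b\neq0$ placed at three consecutive positions, extended in both directions by $b_n=\alpha b_{n-1}-b_{n-2}+\beta$, where $\alpha=\frac{ab+bc+ca}{b^2}-1$ and $\beta=\frac{b^2-ac}{b}$. An integer lens sequence is a lens sequence all of whose terms are integers. -}

module Defs where

open import Data.Integer as ℤ using (ℤ; +_)
open import Data.Integer.GCD using (gcd)
open import Data.Rational as ℚ using (ℚ; 0ℚ; 1ℚ; _÷_; ≢-nonZero)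
open import Data.Product using (Σ; _×_)
open import Relation.Binary.PropositionalEquality using (_≡_; _≢_)

-- The lens parameters of a seed (a, b, c) with b ≠ 0:
--   α = (ab + bc + ca) / b² - 1      (division by b² written as dividing by b twice)
--   β = (b² - ac) / b
lensα : (a b c : ℚ) → b ≢ 0ℚ → ℚ
lensα a b c b≢0 =
  ((((a ℚ.* b) ℚ.+ (b ℚ.* c) ℚ.+ (c ℚ.* a)) ÷ b) {{≢-nonZero b≢0}} ÷ b) {{≢-nonZero b≢0}} ℚ.- 1ℚ

lensβ : (a b c : ℚ) → b ≢ 0ℚ → ℚ
lensβ a b c b≢0 = (((b ℚ.* b) ℚ.- (a ℚ.* c)) ÷ b) {{≢-nonZero b≢0}}

toℚ : ℤ → ℚ
toℚ z = z ℚ./ 1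

-- An integer lens sequence: a bilateral integer sequence s : ℤ → ℤ such that
-- for some position j the seed (s j, s (j+1), s (j+2)) has middle term ≠ 0,
-- and the whole sequence satisfies (in ℚ, hence in ℝ)
--   s n = α s (n-1) - s (n-2) + β   for all n ∈ ℤ,
-- with α, β computed from that seed.  (Satisfying the recurrence for all n
-- is the same as being the bidirectional extension of the seed.)
IsIntegerLensSequence : (ℤ → ℤ) → Set
IsIntegerLensSequence s =
  Σ ℤ λ j →
  Σ (toℚ (s (j ℤ.+ ℤ.1ℤ)) ≢ 0ℚ) λ nz →
  ∀ (n : ℤ) →
    toℚ (s n) ≡
      (lensα (toℚ (s j)) (toℚ (s (j ℤ.+ ℤ.1ℤ))) (toℚ (s (j ℤ.+ + 2))) nz
         ℚ.* toℚ (s (n ℤ.- ℤ.1ℤ)))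
      ℚ.- toℚ (s (n ℤ.- + 2))
      ℚ.+ lensβ (toℚ (s j)) (toℚ (s (j ℤ.+ ℤ.1ℤ))) (toℚ (s (j ℤ.+ + 2))) nz

gcd3 : (ℤ → ℤ) → ℤ → ℤ
gcd3 s k = gcd (gcd (s k) (s (k ℤ.+ ℤ.1ℤ))) (s (k ℤ.+ + 2))

-- Two consecutive instances of the recurrence give
--   b(k+2) - b(k-1) = γ (b(k+1) - b(k)),   γ = α + 1 = P/Q in lowest terms.
-- If Q = 1, then b(k+2) ≡ b(k-1) modulo the ideal (b(k), b(k+1)), so consecutive
-- gcd triples agree.  If Q > 1, then, Q being prime to P, induction on n shows that
-- Q^n divides every difference b(j) - b(i); hence the sequence is constant.
{-# OPTIONS --safe #-}
module Submission where

open import Data.Nat as ℕ using (ℕ; zero; suc; z≤n; s≤s)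
import Data.Nat.Properties as ℕ
import Data.Nat.Divisibility as ℕ
import Data.Nat.Coprimality as ℕ
open import Data.Integer using (ℤ; +_; -[1+_]; 0ℤ; 1ℤ; _+_; _-_; _*_; -_; ∣_∣)
import Data.Integer.Properties as ℤ
open import Data.Integer.Coprimality using (Coprime)
open import Data.Integer.Divisibility.Signed
  using (_∣_; ∣ᵤ⇒∣; ∣⇒∣ᵤ; ∣m⇒∣-m; ∣m∣n⇒∣m+n; ∣n⇒∣m*n; *-monoʳ-∣)
import Data.Integer.Divisibility as ℤᵘ
open import Data.Integer.GCD using (gcd; gcd[i,j]∣i; gcd[i,j]∣j; gcd-greatest)
open import Data.Integer.Tactic.RingSolver using (solve-∀)
open import Data.Product using (Σ; _,_)
open import Data.Rational as ℚ using (ℚ; mkℚ; ↥_; ↧_)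
import Data.Rational.Properties as ℚ
open import Data.Rational.Solver using (module +-*-Solver)
open import Data.Rational.Unnormalised as ℚᵘ using (mkℚᵘ; *≡*)
import Data.Rational.Unnormalised.Properties as ℚᵘ
open import Relation.Nullary using (contradiction)
open import Relation.Binary.Bundles using (Setoid)
open import Relation.Binary.PropositionalEquality
  using (_≡_; refl; sym; trans; cong; cong₂; subst; setoid; module ≡-Reasoning)
open import Defs

n<m^n : ∀ {m} → 1 ℕ.< m → ∀ n → n ℕ.< m ℕ.^ n
n<m^n _ zero = s≤s z≤n
n<m^n {suc zero} (s≤s ()) (suc n)
n<m^n {m@(suc (suc _))} 1<m (suc n) = ℕ.≤-<-trans (n<m^n 1<m n) m^n<m^[1+n]
  where
  m^n<m^[1+n] : m ℕ.^ n ℕ.< m ℕ.^ suc n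
  m^n<m^[1+n] = subst (m ℕ.^ n ℕ.<_) (ℕ.*-comm (m ℕ.^ n) m)
    (ℕ.m<m*n (m ℕ.^ n) m {{ℕ.m^n≢0 m n}} 1<m)

all-powers-divide⇒≡0 : ∀ {m k} → 1 ℕ.< m → (∀ n → m ℕ.^ n ℕ.∣ k) → k ≡ 0
all-powers-divide⇒≡0 {k = zero}  1<m m^n∣k = refl
all-powers-divide⇒≡0 {k = suc k} 1<m m^n∣k =
  contradiction (ℕ.∣⇒≤ (m^n∣k (suc k))) (ℕ.<⇒≱ (n<m^n 1<m (suc k)))

coprime-factors : ∀ {c x} P Q → Coprime P Q → c ∣ P * x → c ∣ Q * x → c ∣ x
coprime-factors {c} {x} P Q coprime c∣Px c∣Qx =
  ∣ᵤ⇒∣ (ℕ.coprime-factors coprime (abs-factor {P} c∣Px , abs-factor {Q} c∣Qx))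
  where
  abs-factor : ∀ {R} → c ∣ R * x → ∣ c ∣ ℕ.∣ ∣ R ∣ ℕ.* ∣ x ∣
  abs-factor {R} c∣Rx = subst (∣ c ∣ ℕ.∣_) (ℤ.abs-* R x) (∣⇒∣ᵤ c∣Rx)

mod-setoid : ℤ → Setoid _ _
mod-setoid c = record
  { Carrier       = ℤ
  ; _≈_           = λ x y → c ∣ y - x
  ; isEquivalence = record
    { refl  = λ {x} → subst (c ∣_) (sym (ℤ.+-inverseʳ x)) (∣ᵤ⇒∣ (∣ c ∣ ℕ.∣0))
    ; sym   = λ {x} {y} c∣y-x → subst (c ∣_) (-[y-x]≡x-y y x) (∣m⇒∣-m c∣y-x)
    ; trans = λ {x} {y} {z} c∣y-x c∣z-y →
        subst (c ∣_) ([z-y]+[y-x]≡z-x x y z) (∣m∣n⇒∣m+n c∣z-y c∣y-x)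
    }
  }
  where
  -[y-x]≡x-y : ∀ y x → - (y - x) ≡ x - y
  -[y-x]≡x-y = solve-∀
  [z-y]+[y-x]≡z-x : ∀ x y z → (z - y) + (y - x) ≡ z - x
  [z-y]+[y-x]≡z-x = solve-∀

module _ {a ℓ} (S : Setoid a ℓ) (f : ℤ → Setoid.Carrier S) where
  open Setoid S using (_≈_; reflexive) renaming (sym to ≈-sym; trans to ≈-trans)

  module _ (step : ∀ k → f k ≈ f (k + 1ℤ)) where

    related-upward : ∀ i n → f i ≈ f (i + + n)
    related-upward i zero    = reflexive (cong f (sym (ℤ.+-identityʳ i)))
    related-upward i (suc n) =
      ≈-trans (related-upward i n) (≈-trans (step (i + + n)) (reflexive (cong f (+-suc i (+ n)))))
      where
      +-suc : ∀ i m → (i + m) + 1ℤ ≡ i + (1ℤ + m)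
      +-suc = solve-∀

    succ-related⇒related : ∀ i j → f i ≈ f j
    succ-related⇒related i j with j - i in j-i≡δ
    ... | + n      = ≈-trans (related-upward i n) (reflexive (cong f i+δ≡j))
      where
      i+[j-i]≡j : ∀ i j → i + (j - i) ≡ j
      i+[j-i]≡j = solve-∀
      i+δ≡j : i + + n ≡ j
      i+δ≡j = trans (cong (λ δ → i + δ) (sym j-i≡δ)) (i+[j-i]≡j i j)
    ... | -[1+ n ] = ≈-sym (≈-trans (related-upward j (suc n)) (reflexive (cong f j-δ≡i)))
      where
      j-[j-i]≡i : ∀ i j → j - (j - i) ≡ i
      j-[j-i]≡i = solve-∀
      j-δ≡i : j - -[1+ n ] ≡ i
      j-δ≡i = trans (cong (λ δ → j - δ) (sym j-i≡δ)) (j-[j-i]≡i i j)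

gcd[gcd[a,b],c]∣a : ∀ a b c → gcd (gcd a b) c ℤᵘ.∣ a
gcd[gcd[a,b],c]∣a a b c =
  ℕ.∣-trans {∣ gcd (gcd a b) c ∣} {∣ gcd a b ∣} (gcd[i,j]∣i (gcd a b) c) (gcd[i,j]∣i a b)

gcd[gcd[a,b],c]∣b : ∀ a b c → gcd (gcd a b) c ℤᵘ.∣ b
gcd[gcd[a,b],c]∣b a b c =
  ℕ.∣-trans {∣ gcd (gcd a b) c ∣} {∣ gcd a b ∣} (gcd[i,j]∣i (gcd a b) c) (gcd[i,j]∣j a b)

gcd[gcd[a,b],c]∣c : ∀ a b c → gcd (gcd a b) c ℤᵘ.∣ c
gcd[gcd[a,b],c]∣c a b c = gcd[i,j]∣j (gcd a b) c

∣-linear-combination : ∀ {d} a b c x y → d ℤᵘ.∣ a → d ℤᵘ.∣ b → d ℤᵘ.∣ c →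
  d ℤᵘ.∣ a + (x * b + y * c)
∣-linear-combination {d} a b c x y d∣a d∣b d∣c = ∣⇒∣ᵤ {d} {a + (x * b + y * c)}
  (∣m∣n⇒∣m+n (∣ᵤ⇒∣ {d} {a} d∣a)
    (∣m∣n⇒∣m+n (∣n⇒∣m*n x (∣ᵤ⇒∣ {d} {b} d∣b)) (∣n⇒∣m*n y (∣ᵤ⇒∣ {d} {c} d∣c))))

gcd-rotate : ∀ a b c x y → gcd (gcd a b) c ≡ gcd (gcd b c) (a + (x * b + y * c))
gcd-rotate a b c x y = cong +_ (ℕ.∣-antisym g∣g′ g′∣g)
  where
  e  = a + (x * b + y * c)
  g  = gcd (gcd a b) c
  g′ = gcd (gcd b c) e
  a≡e+[-x*b+-y*c] : a ≡ e + ((- x) * b + (- y) * c)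
  a≡e+[-x*b+-y*c] = lemma a b c x y
    where
    lemma : ∀ a b c x y → a ≡ (a + (x * b + y * c)) + ((- x) * b + (- y) * c)
    lemma = solve-∀
  g∣g′ : g ℤᵘ.∣ g′
  g∣g′ = gcd-greatest {gcd b c} {e} {g}
    (gcd-greatest {b} {c} {g} (gcd[gcd[a,b],c]∣b a b c) (gcd[gcd[a,b],c]∣c a b c))
    (∣-linear-combination {g} a b c x y
      (gcd[gcd[a,b],c]∣a a b c) (gcd[gcd[a,b],c]∣b a b c) (gcd[gcd[a,b],c]∣c a b c))
  g′∣g : g′ ℤᵘ.∣ g
  g′∣g = gcd-greatest {gcd a b} {c} {g′}
    (gcd-greatest {a} {b} {g′}
      (subst (g′ ℤᵘ.∣_) (sym a≡e+[-x*b+-y*c]) (∣-linear-combination {g′} e b c (- x) (- y)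
        (gcd[gcd[a,b],c]∣c b c e) (gcd[gcd[a,b],c]∣a b c e) (gcd[gcd[a,b],c]∣b b c e)))
      (gcd[gcd[a,b],c]∣a b c e))
    (gcd[gcd[a,b],c]∣b b c e)

↥-↧-coprime : ∀ γ → Coprime (↥ γ) (↧ γ)
↥-↧-coprime (mkℚ _ _ coprime) = ℕ.recompute coprime

toℚᵘ-toℚ : ∀ z → ℚ.toℚᵘ (toℚ z) ℚᵘ.≃ mkℚᵘ z 0
toℚᵘ-toℚ z = ℚ.toℚᵘ-fromℚᵘ (mkℚᵘ z 0)

toℚ-homo-minus : ∀ x y → toℚ (x - y) ≡ toℚ x ℚ.- toℚ y
toℚ-homo-minus x y = ℚ.toℚᵘ-injective (begin
  ℚ.toℚᵘ (toℚ (x - y))                   ≈⟨ toℚᵘ-toℚ (x - y) ⟩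
  mkℚᵘ (x - y) 0                          ≈⟨ *≡* (lemma x y) ⟩
  mkℚᵘ x 0 ℚᵘ.- mkℚᵘ y 0                  ≈⟨ ℚᵘ.+-cong (toℚᵘ-toℚ x) (ℚᵘ.-‿cong (toℚᵘ-toℚ y)) ⟨
  ℚ.toℚᵘ (toℚ x) ℚᵘ.- ℚ.toℚᵘ (toℚ y)      ≈⟨ ℚᵘ.+-congʳ (ℚ.toℚᵘ (toℚ x)) (ℚ.toℚᵘ-homo‿- (toℚ y)) ⟨
  ℚ.toℚᵘ (toℚ x) ℚᵘ.+ ℚ.toℚᵘ (ℚ.- toℚ y)  ≈⟨ ℚ.toℚᵘ-homo-+ (toℚ x) (ℚ.- toℚ y) ⟨
  ℚ.toℚᵘ (toℚ x ℚ.- toℚ y)                ∎)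
  where
  open ℚᵘ.≃-Reasoning
  lemma : ∀ x y → (x - y) * + 1 ≡ (x * + 1 + (- y) * + 1) * + 1
  lemma = solve-∀

toℚ≡*toℚ⇒↧*≡↥* : ∀ γ x y → toℚ x ≡ γ ℚ.* toℚ y → ↧ γ * x ≡ ↥ γ * y
toℚ≡*toℚ⇒↧*≡↥* γ@(mkℚ P q _) x y x≡γy = begin
  + suc q * x          ≡⟨ ℤ.*-comm (+ suc q) x ⟩
  x * + suc q          ≡⟨ cong (λ n → x * + suc n) (ℕ.*-identityʳ q) ⟨
  x * + suc (q ℕ.* 1)  ≡⟨ ℚᵘ.drop-*≡* x≃γy ⟩
  (P * y) * 1ℤ         ≡⟨ ℤ.*-identityʳ (P * y) ⟩
  P * y                ∎
  where
  open ≡-Reasoning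
  x≃γy : mkℚᵘ x 0 ℚᵘ.≃ mkℚᵘ P q ℚᵘ.* mkℚᵘ y 0
  x≃γy = ℚᵘ.≃-trans (ℚᵘ.≃-sym (toℚᵘ-toℚ x)) (ℚᵘ.≃-trans (ℚ.toℚᵘ-cong x≡γy)
    (ℚᵘ.≃-trans (ℚ.toℚᵘ-homo-* γ (toℚ y)) (ℚᵘ.*-congˡ {mkℚᵘ P q} (toℚᵘ-toℚ y))))

lens-recurrence⇒third-order : ∀ (α β x₀ x₁ x₂ x₃ : ℚ) →
  x₂ ≡ α ℚ.* x₁ ℚ.- x₀ ℚ.+ β → x₃ ≡ α ℚ.* x₂ ℚ.- x₁ ℚ.+ β →
  x₃ ℚ.- x₀ ≡ (α ℚ.+ ℚ.1ℚ) ℚ.* (x₂ ℚ.- x₁)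
lens-recurrence⇒third-order α β x₀ x₁ _ _ refl refl =
  solve 4 (λ α β x₀ x₁ →
      (α :* (α :* x₁ :- x₀ :+ β) :- x₁ :+ β) :- x₀
    := (α :+ con ℚ.1ℚ) :* ((α :* x₁ :- x₀ :+ β) :- x₁)) refl α β x₀ x₁
  where open +-*-Solver

DifferenceRelation : ℤ → ℤ → (ℤ → ℤ) → Set
DifferenceRelation P Q s = ∀ k → Q * (s (k + + 2) - s (k - 1ℤ)) ≡ P * (s (k + 1ℤ) - s k)

recurrence⇒difference-relation : ∀ (s : ℤ → ℤ) α β →
  (∀ n → toℚ (s n) ≡ α ℚ.* toℚ (s (n - 1ℤ)) ℚ.- toℚ (s (n - + 2)) ℚ.+ β) →
  DifferenceRelation (↥ (α ℚ.+ ℚ.1ℚ)) (↧ (α ℚ.+ ℚ.1ℚ)) s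
recurrence⇒difference-relation s α β recurrence k =
  toℚ≡*toℚ⇒↧*≡↥* γ (s (k + + 2) - s (k - 1ℤ)) (s (k + 1ℤ) - s k) (begin
    toℚ (s (k + + 2) - s (k - 1ℤ))  ≡⟨ toℚ-homo-minus (s (k + + 2)) (s (k - 1ℤ)) ⟩
    X (k + + 2) ℚ.- X (k - 1ℤ)      ≡⟨ lens-recurrence⇒third-order α β _ _ _ _
                                         (recurrence-at (k + 1ℤ) (k+1-1≡k k) (k+1-2≡k-1 k))
                                         (recurrence-at (k + + 2) (k+2-1≡k+1 k) (k+2-2≡k k)) ⟩
    γ ℚ.* (X (k + 1ℤ) ℚ.- X k)      ≡⟨ cong (γ ℚ.*_) (toℚ-homo-minus (s (k + 1ℤ)) (s k)) ⟨
    γ ℚ.* toℚ (s (k + 1ℤ) - s k)    ∎)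
  where
  open ≡-Reasoning
  γ = α ℚ.+ ℚ.1ℚ
  X : ℤ → ℚ
  X n = toℚ (s n)
  recurrence-at : ∀ n {i j} → n - 1ℤ ≡ i → n - + 2 ≡ j → X n ≡ α ℚ.* X i ℚ.- X j ℚ.+ β
  recurrence-at n refl refl = recurrence n
  k+1-1≡k : ∀ k → (k + 1ℤ) - 1ℤ ≡ k
  k+1-1≡k = solve-∀
  k+1-2≡k-1 : ∀ k → (k + 1ℤ) - + 2 ≡ k - 1ℤ
  k+1-2≡k-1 = solve-∀
  k+2-1≡k+1 : ∀ k → (k + + 2) - 1ℤ ≡ k + 1ℤ
  k+2-1≡k+1 = solve-∀
  k+2-2≡k : ∀ k → (k + + 2) - + 2 ≡ k
  k+2-2≡k = solve-∀

module _ {P : ℤ} {q : ℕ} (coprime : Coprime P (+ q)) {s : ℤ → ℤ}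
         (relation : DifferenceRelation P (+ q) s) where

  q^n∣differences : ∀ n i j → + (q ℕ.^ n) ∣ s j - s i
  q^n∣differences zero    i j = ∣ᵤ⇒∣ (ℕ.1∣ _)
  q^n∣differences (suc n) = succ-related⇒related (mod-setoid (+ (q ℕ.^ suc n))) s step
    where
    step : ∀ k → + (q ℕ.^ suc n) ∣ s (k + 1ℤ) - s k
    step k = subst (_∣ s (k + 1ℤ) - s k) (sym (ℤ.pos-* q (q ℕ.^ n)))
      (coprime-factors P (+ q) coprime q^[n+1]∣P*Δ q^[n+1]∣q*Δ)
      where
      Δ = s (k + 1ℤ) - s k
      q^[n+1]∣P*Δ : + q * + (q ℕ.^ n) ∣ P * Δ
      q^[n+1]∣P*Δ = subst (+ q * + (q ℕ.^ n) ∣_) (relation k)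
        (*-monoʳ-∣ (+ q) (q^n∣differences n (k - 1ℤ) (k + + 2)))
      q^[n+1]∣q*Δ : + q * + (q ℕ.^ n) ∣ + q * Δ
      q^[n+1]∣q*Δ = *-monoʳ-∣ (+ q) (q^n∣differences n k (k + 1ℤ))

  1<q⇒constant : 1 ℕ.< q → ∀ i j → s i ≡ s j
  1<q⇒constant 1<q i j = sym (ℤ.i-j≡0⇒i≡j (s j) (s i) (ℤ.∣i∣≡0⇒i≡0
    (all-powers-divide⇒≡0 1<q λ n → ∣⇒∣ᵤ (q^n∣differences n i j))))

constant⇒difference-relation : ∀ s P Q → (∀ i j → s i ≡ s j) → DifferenceRelation P Q s
constant⇒difference-relation s P Q constant k = begin
  Q * (s (k + + 2) - s (k - 1ℤ))  ≡⟨ cong (Q *_) (ℤ.i≡j⇒i-j≡0 (constant _ _)) ⟩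
  Q * 0ℤ                           ≡⟨ ℤ.*-zeroʳ Q ⟩
  0ℤ                               ≡⟨ ℤ.*-zeroʳ P ⟨
  P * 0ℤ                           ≡⟨ cong (P *_) (ℤ.i≡j⇒i-j≡0 (constant _ _)) ⟨
  P * (s (k + 1ℤ) - s k)           ∎
  where open ≡-Reasoning

clear-denominator : ∀ s P q → Coprime P (+ suc q) → DifferenceRelation P (+ suc q) s →
  DifferenceRelation P 1ℤ s
clear-denominator s P zero    _       relation = relation
clear-denominator s P (suc q) coprime relation =
  constant⇒difference-relation s P 1ℤ (1<q⇒constant {P} coprime relation (s≤s (s≤s z≤n)))

gcd3-succ : ∀ s P → DifferenceRelation P 1ℤ s → ∀ k → gcd3 s k ≡ gcd3 s (k + 1ℤ)
gcd3-succ s P relation k = begin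
  gcd (gcd (s k) b) (s (k + + 2))          ≡⟨ cong₂ (λ a c → gcd (gcd a b) c)
                                                (cong s (k+1-1≡k k)) (cong s (k+1+1≡k+2 k)) ⟨
  gcd (gcd a b) c                          ≡⟨ gcd-rotate a b c (- P) P ⟩
  gcd (gcd b c) (a + ((- P) * b + P * c))  ≡⟨ cong (gcd (gcd b c)) d≡a+[-P*b+P*c] ⟨
  gcd (gcd b c) d                          ∎
  where
  open ≡-Reasoning
  a = s ((k + 1ℤ) - 1ℤ)
  b = s (k + 1ℤ)
  c = s ((k + 1ℤ) + 1ℤ)
  d = s ((k + 1ℤ) + + 2)
  d≡a+[-P*b+P*c] : d ≡ a + ((- P) * b + P * c)
  d≡a+[-P*b+P*c] = begin
    d                        ≡⟨ d≡a+1*[d-a] a d ⟩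
    a + 1ℤ * (d - a)         ≡⟨ cong (λ t → a + t) (relation (k + 1ℤ)) ⟩
    a + P * (c - b)          ≡⟨ a+P*[c-b]≡a+[-P*b+P*c] a b c P ⟩
    a + ((- P) * b + P * c)  ∎
    where
    d≡a+1*[d-a] : ∀ a d → d ≡ a + 1ℤ * (d - a)
    d≡a+1*[d-a] = solve-∀
    a+P*[c-b]≡a+[-P*b+P*c] : ∀ a b c P → a + P * (c - b) ≡ a + ((- P) * b + P * c)
    a+P*[c-b]≡a+[-P*b+P*c] = solve-∀
  k+1-1≡k : ∀ k → (k + 1ℤ) - 1ℤ ≡ k
  k+1-1≡k = solve-∀
  k+1+1≡k+2 : ∀ k → (k + 1ℤ) + 1ℤ ≡ k + + 2
  k+1+1≡k+2 = solve-∀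

proposition4p8 : (s : ℤ → ℤ) → IsIntegerLensSequence s → (m : ℤ) →
    Σ ℤ (λ k → gcd3 s k ≡ m) → (k : ℤ) → gcd3 s k ≡ m
proposition4p8 s (j , b≢0 , recurrence) m (k₀ , gcd3≡m) k =
  trans (succ-related⇒related (setoid ℤ) (gcd3 s) (gcd3-succ s (↥ γ) integral-relation) k k₀) gcd3≡m
  where
  a = toℚ (s j)
  b = toℚ (s (j + 1ℤ))
  c = toℚ (s (j + + 2))
  α = lensα a b c b≢0
  γ = α ℚ.+ ℚ.1ℚ
  integral-relation : DifferenceRelation (↥ γ) 1ℤ s
  integral-relation = clear-denominator s (↥ γ) (ℚ.ℚ.denominator-1 γ) (↥-↧-coprime γ)
    (recurrence⇒difference-relation s α (lensβ a b c b≢0) recurrence)
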